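{- Let $p\ge5$ be a prime and $r$ a positive integer such that $3$ does not divide $p^r+1$. For every $a\in\mathbb{F}_{p^{2r}}^*$, the polynomial $\Pi_a(x)=2ax^{p^r+1}+a^{p^r}x^2$ (which differs from $\Delta_{A,a}(x)=(x+a)^{p^r+2}-x^{p^r+2}$ by an affine function) is EA-equivalent to $x^2$ on $\mathbb{F}_{p^{2r}}$.
   Context: Two functions $f_1,f_2$ on $\mathbb{F}_{q}$ are extended affine (EA) equivalent if there are affine functions $m_1,m_2,m_3$ (affine = additive function $L$ with $L(x+y)=L(x)+L(y)$ plus a constant), with $m_1,m_2$ permutations, such that $f_1=m_1\circ f_2\circ m_2+m_3$. -}

module Defs where

open import Level using (0ℓ)
open import Data.Nat using (ℕ; zero; suc)
open import Data.Fin using (Fin)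
open import Data.Product using (Σ; ∃; _×_; _,_)
open import Relation.Nullary using (¬_)
open import Relation.Binary.PropositionalEquality using (_≡_)
open import Algebra.Structures using (IsCommutativeRing)
open import Function.Bundles using (_↔_)
open import Function.Definitions using (Bijective)

-- A finite field with exactly q elements, presented with propositional
-- equality on its carrier. (Every finite field is isomorphic to such a
-- presentation, and all notions below are invariant under isomorphism.)
record FiniteField (q : ℕ) : Set₁ where
  infixl 6 _+_
  infixl 7 _*_
  field
    Carrier : Set
    _+_ _*_ : Carrier → Carrier → Carrier
    -_ : Carrier → Carrier
    0# 1# : Carrier
    isCommutativeRing : IsCommutativeRing _≡_ _+_ _*_ -_ 0# 1#
    1≢0 : ¬ (1# ≡ 0#)
    inverse : ∀ x → ¬ (x ≡ 0#) → ∃ λ y → x * y ≡ 1#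
    enumeration : Carrier ↔ Fin q

  infixr 8 _^_
  _^_ : Carrier → ℕ → Carrier
  x ^ zero = 1#
  x ^ suc n = x * (x ^ n)

  Additive : (Carrier → Carrier) → Set
  Additive L = ∀ x y → L (x + y) ≡ L x + L y

  Affine : (Carrier → Carrier) → Set
  Affine m = Σ (Carrier → Carrier) λ L → Σ Carrier λ c →
               Additive L × (∀ x → m x ≡ L x + c)

  Permutation : (Carrier → Carrier) → Set
  Permutation m = Bijective _≡_ _≡_ m

  EAEquivalent : (Carrier → Carrier) → (Carrier → Carrier) → Set
  EAEquivalent f₁ f₂ =
    Σ (Carrier → Carrier) λ m₁ → Σ (Carrier → Carrier) λ m₂ → Σ (Carrier → Carrier) λ m₃ →
      Affine m₁ × Affine m₂ × Affine m₃ × Permutation m₁ × Permutation m₂ ×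
      (∀ x → f₁ x ≡ m₁ (f₂ (m₂ x)) + m₃ x)

  two : Carrier
  two = 1# + 1#

  Πpoly : ℕ → Carrier → Carrier → Carrier
  Πpoly Q a x = two * a * (x ^ suc Q) + (a ^ Q) * (x ^ 2)

-- Write x̄ = x ^ Q with Q = p ^ r. Since |F| = Q², Frobenius and Fermat make x ↦ x̄ an involutive
-- field automorphism, so every linearized binomial x ↦ u x + v x̄ is additive, and it is a bijection
-- as soon as u ū ≠ v v̄ (composing with x ↦ ū x - v x̄ multiplies by u ū - v v̄). As 3 divides
-- neither p nor Q + 1, Q ≡ 1 (mod 3); hence 3 divides Q² - 1, so F has a cube root of unity ω ≠ 1
-- (otherwise cubing would be injective and z ^ (k + 2) - z would have too many roots), and ω̄ = ω.
-- For y = x + c x̄ one has α y² - α c² ȳ² = 2 α c (1 - c c̄) x^(Q+1) + α (1 - (c c̄)²) x²; choosing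
-- c c̄ = ω and α c (1 - ω) = a turns the right-hand side into Π_a(x), and both linearized binomials
-- involved are bijective.

module Submission where

open import Defs
open import Level using (0ℓ)
open import Algebra.Core using (Op₁; Op₂)
open import Algebra.Bundles using (CommutativeRing; CommutativeMonoid)
open import Algebra.Structures using (IsCommutativeRing)
import Algebra.Solver.Ring.AlmostCommutativeRing as ACR
open import Data.Nat as ℕ using (ℕ; zero; suc)
import Data.Nat.Properties as ℕ
open import Data.Nat.DivMod using (_%_; _/_; m≡m%n+[m/n]*n; %-distribˡ-*)
open import Data.Nat.Divisibility using (_∣_; divides)
open import Data.Nat.Primality using (Prime; prime?; prime⇒nonZero)
open import Data.Nat.Combinatorics using (_C_; nCn≡1)
open import Data.Nat.Tactic.RingSolver using (solve-∀)
open import Data.Integer as ℤ using (ℤ; -[1+_]; _⊖_)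
import Data.Integer.Properties as ℤ
open import Data.Sign as Sign using (Sign)
open import Data.Maybe using (Maybe; just; nothing)
open import Data.Fin as Fin using (Fin; toℕ; inject₁; fromℕ)
import Data.Fin.Properties as Fin
open import Data.Vec.Functional using (init; tail)
open import Data.List using (List; []; _∷_; length; replicate; tabulate)
import Data.List.Properties as List
open import Data.List.Relation.Unary.All as All using (All; []; _∷_)
import Data.List.Relation.Unary.All.Properties as All
open import Data.List.Relation.Unary.Unique.Propositional using (Unique; []; _∷_)
import Data.List.Relation.Unary.Unique.Propositional.Properties as Unique
open import Data.Product using (∃; _×_; _,_; proj₁; proj₂)
open import Data.Sum using (_⊎_; inj₁; inj₂; [_,_])
open import Function.Base using (_∘_; id; flip)
open import Function.Bundles using (Inverse; Injection; mk⤖)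
open import Function.Properties.Inverse using (↔⇒↣; ↔-sym; ↔-trans)
open import Function.Properties.Bijection using (⤖⇒↔)
open import Relation.Binary.Definitions using (DecidableEquality)
open import Relation.Nullary using (¬_; yes; no; Dec; ¬?; _×-dec_)
open import Relation.Nullary.Decidable using (via-injection; from-yes)
open import Relation.Nullary.Negation using (contradiction)
open import Relation.Binary.PropositionalEquality hiding ([_])

module Arithmetic where
  open import Data.Nat
  open import Data.Nat.Properties
  open import Data.Nat.Divisibility
  open import Data.Nat.DivMod using (_%_; m/n*n≡m; %-distribˡ-+; %-distribˡ-*; m%n<n)
  open import Data.Nat.Primality
  open import Data.Nat.Combinatorics using (_C_; nCk≡n!/k![n-k]!; k![n∸k]!∣n!)

  prime∤1 : ∀ {p} → Prime p → ¬ p ∣ 1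
  prime∤1 p-prime p∣1 = contradiction (∣1⇒≡1 p∣1) (nonTrivial⇒≢1 {{prime⇒nonTrivial p-prime}})

  prime∤! : ∀ {p} → Prime p → ∀ {m} → m < p → ¬ p ∣ m !
  prime∤! p-prime {zero} _ = prime∤1 p-prime
  prime∤! p-prime {suc m} m<p = [ <⇒≱ m<p ∘ ∣⇒≤ , prime∤! p-prime (<-trans (n<1+n m) m<p) ] ∘ euclidsLemma (suc m) (m !) p-prime

  n∣n! : ∀ n → .{{NonZero n}} → n ∣ n !
  n∣n! (suc n) = m∣m*n (n !)

  prime∣C : ∀ {p k} → Prime p → 0 < k → k < p → p ∣ p C k
  prime∣C {p} {k} p-prime 0<k k<p = [ id , flip contradiction p∤k![p∸k]! ] (euclidsLemma (p C k) (k ! * (p ∸ k) !) p-prime p∣C*k![p∸k]!)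
    where
      p∤k![p∸k]! : ¬ p ∣ k ! * (p ∸ k) !
      p∤k![p∸k]! = [ prime∤! p-prime k<p , prime∤! p-prime (∸-monoʳ-< 0<k (<⇒≤ k<p)) ] ∘ euclidsLemma (k !) ((p ∸ k) !) p-prime
      C*k![p∸k]!≡p! : (p C k) * (k ! * (p ∸ k) !) ≡ p !
      C*k![p∸k]!≡p! = trans (cong (_* (k ! * (p ∸ k) !)) (nCk≡n!/k![n-k]! (<⇒≤ k<p))) (m/n*n≡m (k![n∸k]!∣n! (<⇒≤ k<p)))
        where instance _ = k !* (p ∸ k) !≢0
      p∣C*k![p∸k]! : p ∣ (p C k) * (k ! * (p ∸ k) !)
      p∣C*k![p∸k]! = subst (p ∣_) (sym C*k![p∸k]!≡p!) (n∣n! p {{prime⇒nonZero p-prime}})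

  prime≥5⇒3∤ : ∀ {p} → Prime p → 5 ≤ p → ¬ 3 ∣ p
  prime≥5⇒3∤ p-prime 5≤p 3∣p = Prime.notComposite p-prime (composite (≤-trans (s≤s (s≤s (s≤s (s≤s z≤n)))) 5≤p) 3∣p)

  prime∤⇒∤^ : ∀ {d m} → Prime d → ¬ d ∣ m → ∀ n → ¬ d ∣ m ^ n
  prime∤⇒∤^ d-prime d∤m zero = prime∤1 d-prime
  prime∤⇒∤^ {m = m} d-prime d∤m (suc n) = [ d∤m , prime∤⇒∤^ d-prime d∤m n ] ∘ euclidsLemma m (m ^ n) d-prime

  3∤n∧3∤n+1⇒n%3≡1 : ∀ n → ¬ 3 ∣ n → ¬ 3 ∣ n + 1 → n % 3 ≡ 1
  3∤n∧3∤n+1⇒n%3≡1 n 3∤n 3∤n+1 with n % 3 in eq | m%n<n n 3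
  ... | 0 | _ = contradiction (m%n≡0⇒n∣m n 3 eq) 3∤n
  ... | 1 | _ = refl
  ... | 2 | _ = contradiction (m%n≡0⇒n∣m (n + 1) 3 (trans (%-distribˡ-+ n 1 3) (cong (λ r → (r + 1) % 3) eq))) 3∤n+1
  ... | suc (suc (suc _)) | s≤s (s≤s (s≤s ()))

  n%3≡1⇒n*n%3≡1 : ∀ n → n % 3 ≡ 1 → (n * n) % 3 ≡ 1
  n%3≡1⇒n*n%3≡1 n n%3≡1 = trans (%-distribˡ-* n n 3) (cong₂ (λ a b → (a * b) % 3) n%3≡1 n%3≡1)

open Arithmetic

-- The reflective Tactic.RingSolver cannot normalise numerals of an abstract ring, so Algebra.Solver.Ring
-- is instantiated with integer coefficients through the canonical homomorphism ⟦_⟧ : ℤ → A.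
module RingSolver {A : Set} {add mul : Op₂ A} {neg : Op₁ A} {zero one : A}
  (isCommutativeRing : IsCommutativeRing _≡_ add mul neg zero one) where

  commutativeRing : CommutativeRing 0ℓ 0ℓ
  commutativeRing = record { isCommutativeRing = isCommutativeRing }

  open CommutativeRing commutativeRing
    using (_+_; _*_; -_; 0#; 1#; +-comm; +-identityˡ; +-identityʳ; -‿inverseʳ; ring; semiring; +-monoid; +-commutativeSemigroup)
  open import Algebra.Properties.Ring ring using (-‿distribˡ-*; -‿distribʳ-*; -‿involutive; -0#≈0#; -‿+-comm)
  open import Algebra.Properties.CommutativeSemigroup +-commutativeSemigroup using (interchange)
  open import Algebra.Properties.Monoid.Mult.TCOptimised +-monoid using (×-homo-+; 1+×)
  open import Algebra.Properties.Semiring.Mult.TCOptimised semiring using (×1-homo-*) renaming (_×_ to _·_)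

  signed : Sign → A → A
  signed Sign.+ x = x
  signed Sign.- x = - x

  ⟦_⟧ : ℤ → A
  ⟦ i ⟧ = signed (ℤ.sign i) (ℤ.∣ i ∣ · 1#)

  signed-0# : ∀ s → signed s 0# ≡ 0#
  signed-0# Sign.+ = refl
  signed-0# Sign.- = -0#≈0#

  signed-* : ∀ s t x y → signed (s Sign.* t) (x * y) ≡ signed s x * signed t y
  signed-* Sign.+ Sign.+ x y = refl
  signed-* Sign.+ Sign.- x y = -‿distribʳ-* x y
  signed-* Sign.- Sign.+ x y = -‿distribˡ-* x y
  signed-* Sign.- Sign.- x y = begin
    x * y           ≡⟨ sym (-‿involutive (x * y)) ⟩
    - - (x * y)     ≡⟨ cong -_ (-‿distribˡ-* x y) ⟩
    - (- x * y)     ≡⟨ -‿distribʳ-* (- x) y ⟩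
    - x * - y       ∎
    where open ≡-Reasoning

  ⟦◃⟧ : ∀ s n → ⟦ s ℤ.◃ n ⟧ ≡ signed s (n · 1#)
  ⟦◃⟧ s ℕ.zero = sym (signed-0# s)
  ⟦◃⟧ Sign.+ (suc n) = refl
  ⟦◃⟧ Sign.- (suc n) = refl

  ⟦-⟧ : ∀ i → ⟦ ℤ.- i ⟧ ≡ - ⟦ i ⟧
  ⟦-⟧ (ℤ.+ ℕ.zero) = sym -0#≈0#
  ⟦-⟧ (ℤ.+ suc n) = refl
  ⟦-⟧ -[1+ n ] = sym (-‿involutive _)

  ⟦⊖⟧ : ∀ m n → ⟦ m ⊖ n ⟧ ≡ m · 1# + - (n · 1#)
  ⟦⊖⟧ ℕ.zero ℕ.zero = sym (trans (cong (0# +_) -0#≈0#) (+-identityˡ 0#))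
  ⟦⊖⟧ ℕ.zero (suc n) = sym (+-identityˡ _)
  ⟦⊖⟧ (suc m) ℕ.zero = sym (trans (cong (suc m · 1# +_) -0#≈0#) (+-identityʳ _))
  ⟦⊖⟧ (suc m) (suc n) = begin
    ⟦ suc m ⊖ suc n ⟧                          ≡⟨ cong ⟦_⟧ (ℤ.[1+m]⊖[1+n]≡m⊖n m n) ⟩
    ⟦ m ⊖ n ⟧                                  ≡⟨ ⟦⊖⟧ m n ⟩
    M + - N                                    ≡⟨ sym (+-identityˡ _) ⟩
    0# + (M + - N)                             ≡⟨ cong (_+ (M + - N)) (sym (-‿inverseʳ 1#)) ⟩
    (1# + - 1#) + (M + - N)                    ≡⟨ interchange 1# (- 1#) M (- N) ⟩
    (1# + M) + (- 1# + - N)                    ≡⟨ cong ((1# + M) +_) (-‿+-comm 1# N) ⟩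
    (1# + M) + - (1# + N)                      ≡⟨ sym (cong₂ (λ a b → a + - b) (1+× m 1#) (1+× n 1#)) ⟩
    suc m · 1# + - (suc n · 1#)                ∎
    where open ≡-Reasoning
          M = m · 1#
          N = n · 1#

  ⟦+⟧ : ∀ i j → ⟦ i ℤ.+ j ⟧ ≡ ⟦ i ⟧ + ⟦ j ⟧
  ⟦+⟧ -[1+ m ] -[1+ n ] = begin
    - (suc (suc (m ℕ.+ n)) · 1#)                ≡⟨ cong (λ k → - (suc k · 1#)) (sym (ℕ.+-suc m n)) ⟩
    - ((suc m ℕ.+ suc n) · 1#)                  ≡⟨ cong -_ (×-homo-+ 1# (suc m) (suc n)) ⟩
    - (suc m · 1# + suc n · 1#)                 ≡⟨ sym (-‿+-comm _ _) ⟩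
    - (suc m · 1#) + - (suc n · 1#)             ∎
    where open ≡-Reasoning
  ⟦+⟧ -[1+ m ] (ℤ.+ n) = trans (⟦⊖⟧ n (suc m)) (+-comm _ _)
  ⟦+⟧ (ℤ.+ m) -[1+ n ] = ⟦⊖⟧ m (suc n)
  ⟦+⟧ (ℤ.+ m) (ℤ.+ n) = ×-homo-+ 1# m n

  ⟦*⟧ : ∀ i j → ⟦ i ℤ.* j ⟧ ≡ ⟦ i ⟧ * ⟦ j ⟧
  ⟦*⟧ i j = begin
    ⟦ (s Sign.* t) ℤ.◃ (m ℕ.* n) ⟧              ≡⟨ ⟦◃⟧ (s Sign.* t) (m ℕ.* n) ⟩
    signed (s Sign.* t) ((m ℕ.* n) · 1#)       ≡⟨ cong (signed (s Sign.* t)) (×1-homo-* m n) ⟩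
    signed (s Sign.* t) (m · 1# * n · 1#)      ≡⟨ signed-* s t _ _ ⟩
    ⟦ i ⟧ * ⟦ j ⟧                              ∎
    where open ≡-Reasoning
          s = ℤ.sign i
          t = ℤ.sign j
          m = ℤ.∣ i ∣
          n = ℤ.∣ j ∣

  private
    almostCommutativeRing : ACR.AlmostCommutativeRing 0ℓ 0ℓ
    almostCommutativeRing = ACR.fromCommutativeRing commutativeRing

    ℤ-morphism : ACR._-Raw-AlmostCommutative⟶_ ℤ.+-*-rawRing almostCommutativeRing
    ℤ-morphism = record
      { ⟦_⟧ = ⟦_⟧ ; +-homo = ⟦+⟧ ; *-homo = ⟦*⟧ ; -‿homo = ⟦-⟧ ; 0-homo = refl ; 1-homo = refl }

    ⟦⟧-equal? : ∀ i j → Maybe (⟦ i ⟧ ≡ ⟦ j ⟧)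
    ⟦⟧-equal? i j with i ℤ.≟ j
    ... | yes refl = just refl
    ... | no _ = nothing

  open import Algebra.Solver.Ring ℤ.+-*-rawRing almostCommutativeRing ℤ-morphism ⟦⟧-equal? public
    using (Polynomial; solve; _:+_; _:*_; :-_; _:-_; _:=_; con)

  :0 :1 : ∀ {n} → Polynomial n
  :0 = con (ℤ.+ 0)
  :1 = con (ℤ.+ 1)

module FiniteFieldProperties {q : ℕ} (F : FiniteField q) where

  open FiniteField F
  open RingSolver isCommutativeRing public using (commutativeRing; solve; _:+_; _:*_; :-_; _:-_; _:=_; :0; :1)
  open CommutativeRing commutativeRing public
    using ( +-assoc; +-comm; +-identityˡ; +-identityʳ; -‿inverseʳ
          ; *-assoc; *-comm; *-identityˡ; *-identityʳ; zeroˡ; zeroʳ; distribʳ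
          ; ring; semiring; +-monoid; commutativeSemiring; +-commutativeMonoid; *-commutativeMonoid; +-group)
  open import Algebra.Properties.Ring ring public using (-0#≈0#)
  open import Algebra.Properties.Group +-group public using (x∙y⁻¹≈ε⇒x≈y; identityʳ-unique; inverseʳ-unique)
  open import Algebra.Properties.Semiring.Mult semiring public using (×1-homo-*) renaming (_×_ to _·_)
  import Algebra.Properties.CommutativeSemiring.Exp commutativeSemiring as Exp

  infix 4 _≟_
  _≟_ : DecidableEquality Carrier
  _≟_ = via-injection (↔⇒↣ enumeration) Fin._≟_

  -- The junk value 0# ⁻¹ = 0# makes the inverse total.
  infix 9 _⁻¹
  _⁻¹ : Carrier → Carrier
  x ⁻¹ with x ≟ 0#
  ... | yes _ = 0#
  ... | no x≢0 = proj₁ (inverse x x≢0)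

  ⁻¹-inverseʳ : ∀ {x} → ¬ x ≡ 0# → x * x ⁻¹ ≡ 1#
  ⁻¹-inverseʳ {x} x≢0 with x ≟ 0#
  ... | yes x≡0 = contradiction x≡0 x≢0
  ... | no x≢0 = proj₂ (inverse x x≢0)

  ⁻¹-inverseˡ : ∀ {x} → ¬ x ≡ 0# → x ⁻¹ * x ≡ 1#
  ⁻¹-inverseˡ {x} x≢0 = trans (*-comm (x ⁻¹) x) (⁻¹-inverseʳ x≢0)

  ⁻¹-cancelˡ : ∀ {c} x → ¬ c ≡ 0# → c ⁻¹ * (c * x) ≡ x
  ⁻¹-cancelˡ {c} x c≢0 = begin
    c ⁻¹ * (c * x)   ≡⟨ sym (*-assoc (c ⁻¹) c x) ⟩
    (c ⁻¹ * c) * x   ≡⟨ cong (_* x) (⁻¹-inverseˡ c≢0) ⟩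
    1# * x           ≡⟨ *-identityˡ x ⟩
    x                ∎
    where open ≡-Reasoning

  ⁻¹-cancelʳ : ∀ {c} x → ¬ c ≡ 0# → c * (c ⁻¹ * x) ≡ x
  ⁻¹-cancelʳ {c} x c≢0 = begin
    c * (c ⁻¹ * x)   ≡⟨ sym (*-assoc c (c ⁻¹) x) ⟩
    (c * c ⁻¹) * x   ≡⟨ cong (_* x) (⁻¹-inverseʳ c≢0) ⟩
    1# * x           ≡⟨ *-identityˡ x ⟩
    x                ∎
    where open ≡-Reasoning

  *-cancelˡ : ∀ {c} x y → ¬ c ≡ 0# → c * x ≡ c * y → x ≡ y
  *-cancelˡ {c} x y c≢0 cx≡cy = begin
    x                ≡⟨ sym (⁻¹-cancelˡ x c≢0) ⟩
    c ⁻¹ * (c * x)   ≡⟨ cong (c ⁻¹ *_) cx≡cy ⟩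
    c ⁻¹ * (c * y)   ≡⟨ ⁻¹-cancelˡ y c≢0 ⟩
    y                ∎
    where open ≡-Reasoning

  x*y≡0⇒x≡0⊎y≡0 : ∀ {x y} → x * y ≡ 0# → x ≡ 0# ⊎ y ≡ 0#
  x*y≡0⇒x≡0⊎y≡0 {x} {y} xy≡0 with x ≟ 0#
  ... | yes x≡0 = inj₁ x≡0
  ... | no x≢0 = inj₂ (*-cancelˡ y 0# x≢0 (trans xy≡0 (sym (zeroʳ x))))

  x≢0∧y≢0⇒x*y≢0 : ∀ {x y} → ¬ x ≡ 0# → ¬ y ≡ 0# → ¬ x * y ≡ 0#
  x≢0∧y≢0⇒x*y≢0 x≢0 y≢0 = [ x≢0 , y≢0 ] ∘ x*y≡0⇒x≡0⊎y≡0

  ^≡^ : ∀ x n → x ^ n ≡ x Exp.^ n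
  ^≡^ x zero = refl
  ^≡^ x (suc n) = cong (x *_) (^≡^ x n)

  ^-homo-* : ∀ x m n → x ^ (m ℕ.+ n) ≡ x ^ m * x ^ n
  ^-homo-* x m n rewrite ^≡^ x (m ℕ.+ n) | ^≡^ x m | ^≡^ x n = Exp.^-homo-* x m n

  ^-assocʳ : ∀ x m n → (x ^ m) ^ n ≡ x ^ (m ℕ.* n)
  ^-assocʳ x m n rewrite ^≡^ x m | ^≡^ (x Exp.^ m) n | ^≡^ x (m ℕ.* n) = Exp.^-assocʳ x m n

  ^-distrib-* : ∀ x y n → (x * y) ^ n ≡ x ^ n * y ^ n
  ^-distrib-* x y n rewrite ^≡^ (x * y) n | ^≡^ x n | ^≡^ y n = Exp.^-distrib-* x y n

  1^n≡1 : ∀ n → 1# ^ n ≡ 1#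
  1^n≡1 zero = refl
  1^n≡1 (suc n) = trans (*-identityˡ _) (1^n≡1 n)

  x^n≡0⇒x≡0 : ∀ {x} n → x ^ n ≡ 0# → x ≡ 0#
  x^n≡0⇒x≡0 zero 1≡0 = contradiction 1≡0 1≢0
  x^n≡0⇒x≡0 (suc n) = [ id , x^n≡0⇒x≡0 n ] ∘ x*y≡0⇒x≡0⊎y≡0

  ×1-homo-^ : ∀ m n → (m ℕ.^ n) · 1# ≡ (m · 1#) ^ n
  ×1-homo-^ m zero = +-identityʳ 1#
  ×1-homo-^ m (suc n) = trans (×1-homo-* m (m ℕ.^ n)) (cong ((m · 1#) *_) (×1-homo-^ m n))

  inverse⇒permutation : ∀ {σ} τ → (∀ x → σ (τ x) ≡ x) → (∀ x → τ (σ x) ≡ x) → Permutation σ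
  inverse⇒permutation {σ} τ στ≗id τσ≗id =
    (λ {x} {y} σx≡σy → trans (sym (τσ≗id x)) (trans (cong τ σx≡σy) (τσ≗id y))) ,
    (λ y → τ y , λ { refl → στ≗id y })

  open Inverse enumeration using (to; from) renaming (inverseˡ to to∘from; inverseʳ to from∘to)

  module FieldSum {c ℓ} (M : CommutativeMonoid c ℓ) where
    open CommutativeMonoid M using (_≈_; _∙_; ε; identityʳ; ∙-congˡ) renaming (Carrier to A; trans to ≈-trans; reflexive to ≈-reflexive)
    open import Algebra.Properties.CommutativeMonoid.Sum M
      using (sum-permute; sum-cong-≗; sum-cong-≋; sum-remove; sum-replicate; sum-replicate-zero; ∑-distrib-+)
    open import Algebra.Properties.Monoid.Mult (CommutativeMonoid.monoid M) using () renaming (_×_ to _×ᴹ_)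
    open import Algebra.Properties.CommutativeMonoid.Sum M public using (sum)

    sum-single : ∀ {n} (t : Fin n → A) i → (∀ j → ¬ j ≡ i → t j ≈ ε) → sum t ≈ t i
    sum-single {suc n} t i t≈ε = ≈-trans (sum-remove {i = i} t) (≈-trans (∙-congˡ rest≈ε) (identityʳ (t i)))
      where rest≈ε = ≈-trans (sum-cong-≋ {n} (λ j → t≈ε (Fin.punchIn i j) (Fin.punchInᵢ≢i i j))) (sum-replicate-zero n)

    ∑ : (Carrier → A) → A
    ∑ f = sum (f ∘ from)

    ∑-∘-permutation : ∀ f {σ} → Permutation σ → ∑ f ≈ ∑ (f ∘ σ)
    ∑-∘-permutation f σ-bijective = ≈-trans (sum-permute (f ∘ from) π) (≈-reflexive (sum-cong-≗ {q} λ i → cong f (from∘to refl)))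
      where π = ↔-trans (↔-sym enumeration) (↔-trans (⤖⇒↔ (mk⤖ σ-bijective)) enumeration)

    ∑-single : ∀ f x₀ → (∀ x → ¬ x ≡ x₀ → f x ≈ ε) → ∑ f ≈ f x₀
    ∑-single f x₀ f≈ε = ≈-trans (sum-single (f ∘ from) (to x₀) (λ i i≢ → f≈ε (from i) (λ { refl → i≢ (sym (to∘from refl)) })))
                                 (≈-reflexive (cong f (from∘to refl)))

    ∑-distrib : ∀ f g → ∑ (λ x → f x ∙ g x) ≈ ∑ f ∙ ∑ g
    ∑-distrib f g = ∑-distrib-+ (f ∘ from) (g ∘ from)

    ∑-const : ∀ c → ∑ (λ _ → c) ≈ q ×ᴹ c
    ∑-const c = sum-replicate q

    ∑-cong : ∀ {f g} → (∀ x → f x ≡ g x) → ∑ f ≡ ∑ g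
    ∑-cong f≗g = sum-cong-≗ {q} (f≗g ∘ from)

  +-permutation : ∀ a → Permutation (_+ a)
  +-permutation a = inverse⇒permutation (_+ - a) (x-a+a≡x a) (x+a-a≡x a)
    where
      x-a+a≡x : ∀ a x → x + - a + a ≡ x
      x-a+a≡x = solve 2 (λ a x → x :- a :+ a := x) refl
      x+a-a≡x : ∀ a x → x + a + - a ≡ x
      x+a-a≡x = solve 2 (λ a x → x :+ a :- a := x) refl

  *-permutation : ∀ {a} → ¬ a ≡ 0# → Permutation (a *_)
  *-permutation {a} a≢0 = inverse⇒permutation (a ⁻¹ *_) (λ x → ⁻¹-cancelʳ x a≢0) (λ x → ⁻¹-cancelˡ x a≢0)

  -- ∑ x = ∑ (x + 1) = ∑ x + q · 1
  characteristic : q · 1# ≡ 0#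
  characteristic = identityʳ-unique (∑ id) (q · 1#) (begin
    ∑ id + q · 1#             ≡⟨ cong (∑ id +_) (sym (∑-const 1#)) ⟩
    ∑ id + ∑ (λ _ → 1#)       ≡⟨ sym (∑-distrib id (λ _ → 1#)) ⟩
    ∑ (λ x → x + 1#)          ≡⟨ sym (∑-∘-permutation id (+-permutation 1#)) ⟩
    ∑ id                      ∎)
    where
      open FieldSum +-commutativeMonoid
      open ≡-Reasoning

  unit : Carrier → Carrier
  unit x with x ≟ 0#
  ... | yes _ = 1#
  ... | no _ = x

  unit≢0 : ∀ x → ¬ unit x ≡ 0#
  unit≢0 x with x ≟ 0#
  ... | yes _ = 1≢0
  ... | no x≢0 = x≢0

  atZero : Carrier → Carrier → Carrier
  atZero a x with x ≟ 0#
  ... | yes _ = a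
  ... | no _ = 1#

  unit-*-atZero : ∀ {a} → ¬ a ≡ 0# → ∀ x → unit (a * x) * atZero a x ≡ a * unit x
  unit-*-atZero {a} a≢0 x with x ≟ 0# | a * x ≟ 0#
  ... | yes _ | yes _ = trans (*-identityˡ a) (sym (*-identityʳ a))
  ... | yes refl | no ax≢0 = contradiction (zeroʳ a) ax≢0
  ... | no x≢0 | yes ax≡0 = contradiction ax≡0 (x≢0∧y≢0⇒x*y≢0 a≢0 x≢0)
  ... | no _ | no _ = *-identityʳ (a * x)

  module Product = FieldSum *-commutativeMonoid
  open Product using () renaming (∑ to ∏)

  product≢0 : ∀ {n} (t : Fin n → Carrier) → (∀ i → ¬ t i ≡ 0#) → ¬ Product.sum t ≡ 0#
  product≢0 {zero} t t≢0 = 1≢0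
  product≢0 {suc n} t t≢0 = x≢0∧y≢0⇒x*y≢0 (t≢0 Fin.zero) (product≢0 (t ∘ Fin.suc) (t≢0 ∘ Fin.suc))

  ∏-atZero : ∀ a → ∏ (atZero a) ≡ a
  ∏-atZero a = trans (Product.∑-single (atZero a) 0# atZero-≢0) atZero-0
    where
      atZero-≢0 : ∀ x → ¬ x ≡ 0# → atZero a x ≡ 1#
      atZero-≢0 x x≢0 with x ≟ 0#
      ... | yes x≡0 = contradiction x≡0 x≢0
      ... | no _ = refl
      atZero-0 : atZero a 0# ≡ a
      atZero-0 with 0# ≟ 0#
      ... | yes _ = refl
      ... | no 0≢0 = contradiction refl 0≢0

  0^q≡0 : 0# ^ q ≡ 0#
  0^q≡0 = 0^|Fin| (to 0#)
    where
      0^|Fin| : ∀ {n} → Fin n → 0# ^ n ≡ 0#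
      0^|Fin| {suc n} _ = zeroˡ _

  -- x ↦ a x permutes the field, so ∏ unit (a x) = ∏ unit x, whereas ∏ a · unit x = a ^ q · ∏ unit x.
  fermat : ∀ x → x ^ q ≡ x
  fermat a with a ≟ 0#
  ... | yes refl = 0^q≡0
  ... | no a≢0 = sym (*-cancelˡ a (a ^ q) (product≢0 (unit ∘ from) (unit≢0 ∘ from)) (begin
    P * a                                   ≡⟨ cong₂ _*_ (Product.∑-∘-permutation unit (*-permutation a≢0)) (sym (∏-atZero a)) ⟩
    ∏ (λ x → unit (a * x)) * ∏ (atZero a)   ≡⟨ sym (Product.∑-distrib (λ x → unit (a * x)) (atZero a)) ⟩
    ∏ (λ x → unit (a * x) * atZero a x)     ≡⟨ Product.∑-cong (unit-*-atZero a≢0) ⟩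
    ∏ (λ x → a * unit x)                    ≡⟨ Product.∑-distrib (λ _ → a) unit ⟩
    ∏ (λ _ → a) * P                         ≡⟨ cong (_* P) (trans (Product.∑-const a) (sym (^≡^ a q))) ⟩
    a ^ q * P                               ≡⟨ *-comm (a ^ q) P ⟩
    P * a ^ q                               ∎))
    where
      open ≡-Reasoning
      P = ∏ unit

  q≡p^n⇒p·1≡0 : ∀ {p} n → q ≡ p ℕ.^ n → p · 1# ≡ 0#
  q≡p^n⇒p·1≡0 {p} n q≡p^n = x^n≡0⇒x≡0 n (trans (sym (×1-homo-^ p n)) (trans (cong (_· 1#) (sym q≡p^n)) characteristic))

  q≡Q*Q⇒[x^Q]^Q≡x : ∀ {Q} → q ≡ Q ℕ.* Q → ∀ x → (x ^ Q) ^ Q ≡ x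
  q≡Q*Q⇒[x^Q]^Q≡x {Q} q≡Q*Q x = trans (^-assocʳ x Q Q) (trans (cong (x ^_) (sym q≡Q*Q)) (fermat x))

  -- monic cs is the monic polynomial c₀ + c₁ x + ⋯ + x ^ length cs, where cs = c₀ ∷ c₁ ∷ ⋯
  monic : List Carrier → Carrier → Carrier
  monic [] x = 1#
  monic (c ∷ cs) x = c + x * monic cs x

  -- synthetic division by x - r
  quotient : Carrier → List Carrier → List Carrier
  quotient r [] = []
  quotient r (b ∷ cs) = monic (b ∷ cs) r ∷ quotient r cs

  length-quotient : ∀ r cs → length (quotient r cs) ≡ length cs
  length-quotient r [] = refl
  length-quotient r (b ∷ cs) = cong suc (length-quotient r cs)

  monic-division : ∀ r c cs x → monic (c ∷ cs) x ≡ (x + - r) * monic (quotient r cs) x + monic (c ∷ cs) r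
  monic-division r c [] x = solve 3 (λ r c x → c :+ x :* :1 := (x :- r) :* :1 :+ (c :+ r :* :1)) refl r c x
  monic-division r c (b ∷ cs) x = begin
    c + x * monic (b ∷ cs) x                    ≡⟨ cong (λ g → c + x * g) (monic-division r b cs x) ⟩
    c + x * ((x + - r) * h + g)                 ≡⟨ solve 5 (λ r c x h g → c :+ x :* ((x :- r) :* h :+ g) := (x :- r) :* (g :+ x :* h) :+ (c :+ r :* g)) refl r c x h g ⟩
    (x + - r) * (g + x * h) + (c + r * g)       ∎
    where
      open ≡-Reasoning
      h = monic (quotient r cs) x
      g = monic (b ∷ cs) r

  distinct-roots≤degree : ∀ cs {rs} → Unique rs → All (λ r → monic cs r ≡ 0#) rs → length rs ℕ.≤ length cs
  distinct-roots≤degree cs [] [] = ℕ.z≤n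
  distinct-roots≤degree [] (_ ∷ _) (1≡0 ∷ _) = contradiction 1≡0 1≢0
  distinct-roots≤degree (c ∷ cs) {r ∷ rs} (r≢rs ∷ unique) (root ∷ roots) = ℕ.s≤s (subst (length rs ℕ.≤_) (length-quotient r cs)
    (distinct-roots≤degree (quotient r cs) unique (All.zipWith quotient-root (r≢rs , roots))))
    where
      quotient-root : ∀ {s} → ¬ r ≡ s × monic (c ∷ cs) s ≡ 0# → monic (quotient r cs) s ≡ 0#
      quotient-root {s} (r≢s , s-root) =
        [ (λ s-r≡0 → contradiction (sym (x∙y⁻¹≈ε⇒x≈y s r s-r≡0)) r≢s) , id ] (x*y≡0⇒x≡0⊎y≡0 (begin
          (s + - r) * monic (quotient r cs) s                     ≡⟨ sym (+-identityʳ _) ⟩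
          (s + - r) * monic (quotient r cs) s + 0#                ≡⟨ cong ((s + - r) * monic (quotient r cs) s +_) (sym root) ⟩
          (s + - r) * monic (quotient r cs) s + monic (c ∷ cs) r  ≡⟨ sym (monic-division r c cs s) ⟩
          monic (c ∷ cs) s                                        ≡⟨ s-root ⟩
          0#                                                      ∎))
        where open ≡-Reasoning

  monic-replicate-0 : ∀ n x → monic (replicate n 0#) x ≡ x ^ n
  monic-replicate-0 zero x = refl
  monic-replicate-0 (suc n) x = trans (+-identityˡ _) (cong (x *_) (monic-replicate-0 n x))

  cube-injective : (∀ t → t ^ 3 ≡ 1# → t ≡ 1#) → ∀ x y → x ^ 3 ≡ y ^ 3 → x ≡ y
  cube-injective trivial x y x³≡y³ with y ≟ 0#
  ... | yes refl = x^n≡0⇒x≡0 3 (trans x³≡y³ (zeroˡ _))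
  ... | no y≢0 = begin
    x                   ≡⟨ sym (*-identityʳ x) ⟩
    x * 1#              ≡⟨ cong (x *_) (sym (⁻¹-inverseˡ y≢0)) ⟩
    x * (y ⁻¹ * y)      ≡⟨ sym (*-assoc x (y ⁻¹) y) ⟩
    t * y               ≡⟨ cong (_* y) t≡1 ⟩
    1# * y              ≡⟨ *-identityˡ y ⟩
    y                   ∎
    where
      open ≡-Reasoning
      t = x * y ⁻¹
      t≡1 : t ≡ 1#
      t≡1 = trivial t (begin
        (x * y ⁻¹) ^ 3       ≡⟨ ^-distrib-* x (y ⁻¹) 3 ⟩
        x ^ 3 * y ⁻¹ ^ 3     ≡⟨ cong (_* y ⁻¹ ^ 3) x³≡y³ ⟩
        y ^ 3 * y ⁻¹ ^ 3     ≡⟨ sym (^-distrib-* y (y ⁻¹) 3) ⟩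
        (y * y ⁻¹) ^ 3       ≡⟨ cong (_^ 3) (⁻¹-inverseʳ y≢0) ⟩
        1# ^ 3               ≡⟨ 1^n≡1 3 ⟩
        1#                   ∎)

  2≤q : 2 ℕ.≤ q
  2≤q = distinct⇒2≤ (to 0#) (to 1#) (λ to0≡to1 → 1≢0 (sym (Injection.injective (↔⇒↣ enumeration) to0≡to1)))
    where
      distinct⇒2≤ : ∀ {n} (i j : Fin n) → ¬ i ≡ j → 2 ℕ.≤ n
      distinct⇒2≤ {1} Fin.zero Fin.zero i≢j = contradiction refl i≢j
      distinct⇒2≤ {suc (suc n)} _ _ _ = ℕ.s≤s (ℕ.s≤s ℕ.z≤n)

  nontrivialCubeRootOfUnity? : Dec (∃ λ ω → ¬ ω ≡ 1# × ω ^ 3 ≡ 1#)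
  nontrivialCubeRootOfUnity? with Fin.any? (λ i → ¬? (from i ≟ 1#) ×-dec (from i ^ 3 ≟ 1#))
  ... | yes (i , ω≢1 , ω³≡1) = yes (from i , ω≢1 , ω³≡1)
  ... | no ∄i = no λ (ω , ω≢1 , ω³≡1) → ∄i (to ω , subst (λ x → ¬ x ≡ 1# × x ^ 3 ≡ 1#) (sym (from∘to refl)) (ω≢1 , ω³≡1))

  monic-z^[k+2]-z : ∀ k z → monic (0# ∷ - 1# ∷ replicate k 0#) z ≡ z ^ (2 ℕ.+ k) + - z
  monic-z^[k+2]-z k z = begin
    0# + z * (- 1# + z * monic (replicate k 0#) z)   ≡⟨ cong (λ w → 0# + z * (- 1# + z * w)) (monic-replicate-0 k z) ⟩
    0# + z * (- 1# + z * z ^ k)                      ≡⟨ solve 2 (λ z w → :0 :+ z :* (:- :1 :+ z :* w) := z :* (z :* w) :- z) refl z (z ^ k) ⟩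
    z ^ (2 ℕ.+ k) + - z                              ∎
    where open ≡-Reasoning

  cube^[k+2]≡cube : ∀ {k} → q ≡ suc (suc k ℕ.* 3) → ∀ y → (y ^ 3) ^ (2 ℕ.+ k) ≡ y ^ 3
  cube^[k+2]≡cube {k} q≡1+[k+1]*3 y = begin
    (y ^ 3) ^ (2 ℕ.+ k)     ≡⟨ ^-assocʳ y 3 (2 ℕ.+ k) ⟩
    y ^ (3 ℕ.* (2 ℕ.+ k))   ≡⟨ cong (y ^_) (trans (3[2+k]≡2+[1+[k+1]*3] k) (cong (2 ℕ.+_) (sym q≡1+[k+1]*3))) ⟩
    y ^ (2 ℕ.+ q)           ≡⟨ ^-homo-* y 2 q ⟩
    y ^ 2 * y ^ q           ≡⟨ cong (y ^ 2 *_) (fermat y) ⟩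
    y ^ 2 * y               ≡⟨ *-comm (y ^ 2) y ⟩
    y ^ 3                   ∎
    where
      open ≡-Reasoning
      3[2+k]≡2+[1+[k+1]*3] : ∀ k → 3 ℕ.* (2 ℕ.+ k) ≡ 2 ℕ.+ suc (suc k ℕ.* 3)
      3[2+k]≡2+[1+[k+1]*3] = solve-∀

  -- The q distinct cubes would all be roots of z ^ (k + 2) - z, of degree k + 2 < q.
  cube-not-injective : ∀ k → q ≡ suc (suc k ℕ.* 3) → ¬ (∀ x y → x ^ 3 ≡ y ^ 3 → x ≡ y)
  cube-not-injective k q≡1+[k+1]*3 cube-injective =
    ℕ.<⇒≱ 2+k<q (subst₂ ℕ._≤_ length-cubes (cong (2 ℕ.+_) (List.length-replicate k)) (distinct-roots≤degree (0# ∷ - 1# ∷ replicate k 0#) unique roots))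
    where
      cubes = tabulate (λ i → from i ^ 3)
      length-cubes : length cubes ≡ q
      length-cubes = List.length-tabulate (λ i → from i ^ 3)
      unique : Unique cubes
      unique = Unique.tabulate⁺ λ cubes≡ → trans (sym (to∘from refl)) (trans (cong to (cube-injective _ _ cubes≡)) (to∘from refl))
      roots : All (λ z → monic (0# ∷ - 1# ∷ replicate k 0#) z ≡ 0#) cubes
      roots = All.tabulate⁺ λ i → trans (monic-z^[k+2]-z k (from i ^ 3))
                (trans (cong (_+ - (from i ^ 3)) (cube^[k+2]≡cube {k} q≡1+[k+1]*3 (from i))) (-‿inverseʳ _))
      2+k<q : 2 ℕ.+ k ℕ.< q
      2+k<q = subst (2 ℕ.+ k ℕ.<_) (sym q≡1+[k+1]*3) (ℕ.s≤s (ℕ.s≤s (ℕ.s≤s (ℕ.≤-trans (ℕ.m≤m*n k 3) (ℕ.n≤1+n _)))))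

  nontrivialCubeRootOfUnity : q % 3 ≡ 1 → ∃ λ ω → ¬ ω ≡ 1# × ω ^ 3 ≡ 1#
  nontrivialCubeRootOfUnity q%3≡1 with nontrivialCubeRootOfUnity?
  ... | yes ω = ω
  ... | no ∄ω with q / 3 | trans (m≡m%n+[m/n]*n q 3) (cong (ℕ._+ (q / 3) ℕ.* 3) q%3≡1)
  ...   | zero | q≡1 = contradiction (subst (2 ℕ.≤_) q≡1 2≤q) λ { (ℕ.s≤s ()) }
  ...   | suc k | q≡1+[k+1]*3 = contradiction (cube-injective trivial) (cube-not-injective k q≡1+[k+1]*3)
    where
      trivial : ∀ t → t ^ 3 ≡ 1# → t ≡ 1#
      trivial t t³≡1 with t ≟ 1#
      ... | yes t≡1 = t≡1
      ... | no t≢1 = contradiction (t , t≢1 , t³≡1) ∄ω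

  x³≡1⇒x^n≡x : ∀ {x} → x ^ 3 ≡ 1# → ∀ n → n % 3 ≡ 1 → x ^ n ≡ x
  x³≡1⇒x^n≡x {x} x³≡1 n n%3≡1 = begin
    x ^ n                       ≡⟨ cong (x ^_) (trans (m≡m%n+[m/n]*n n 3) (cong (ℕ._+ k ℕ.* 3) n%3≡1)) ⟩
    x * x ^ (k ℕ.* 3)           ≡⟨ cong (λ m → x * x ^ m) (ℕ.*-comm k 3) ⟩
    x * x ^ (3 ℕ.* k)           ≡⟨ cong (x *_) (sym (^-assocʳ x 3 k)) ⟩
    x * (x ^ 3) ^ k             ≡⟨ cong (λ y → x * y ^ k) x³≡1 ⟩
    x * 1# ^ k                  ≡⟨ cong (x *_) (1^n≡1 k) ⟩
    x * 1#                      ≡⟨ *-identityʳ x ⟩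
    x                           ∎
    where
      open ≡-Reasoning
      k = n / 3

module FrobeniusMap {q : ℕ} (F : FiniteField q) {p : ℕ} (p-prime : Prime p) where
  open FiniteField F
  open FiniteFieldProperties F
  open import Algebra.Properties.Semiring.Exp semiring using () renaming (_^_ to _^ˢ_)
  open import Algebra.Properties.Semiring.Mult semiring using (×-assoc-*)
  open import Algebra.Properties.CommutativeSemiring.Binomial commutativeSemiring using (theorem; binomialTerm)

  open import Algebra.Properties.Monoid.Sum +-monoid using (sum; sum-init-last; sum-cong-≗; sum-replicate-zero)
  open import Data.Vec.Functional using (init; tail)

  sum-ends : ∀ {n} (t : Fin (suc (suc n)) → Carrier) → (∀ i → t (Fin.suc (inject₁ i)) ≡ 0#) →
             sum t ≡ t Fin.zero + t (fromℕ (suc n))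
  sum-ends {n} t middle≡0 = begin
    t Fin.zero + sum (tail t)                             ≡⟨ cong (t Fin.zero +_) (sum-init-last (tail t)) ⟩
    t Fin.zero + (sum (init (tail t)) + t (fromℕ (suc n))) ≡⟨ cong (λ s → t Fin.zero + (s + t (fromℕ (suc n)))) middle ⟩
    t Fin.zero + (0# + t (fromℕ (suc n)))                 ≡⟨ cong (t Fin.zero +_) (+-identityˡ _) ⟩
    t Fin.zero + t (fromℕ (suc n))                        ∎
    where
      open ≡-Reasoning
      middle : sum (init (tail t)) ≡ 0#
      middle = trans (sum-cong-≗ middle≡0) (sum-replicate-zero n)

  ^-homo-+ : ∀ {m} x y → 0 ℕ.< m → (∀ {k} z → 0 ℕ.< k → k ℕ.< m → (m C k) · z ≡ 0#) → (x + y) ^ m ≡ x ^ m + y ^ m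
  ^-homo-+ {suc n} x y _ middle≡0 = begin
    (x + y) ^ suc n                                    ≡⟨ ^≡^ (x + y) (suc n) ⟩
    (x + y) ^ˢ suc n                                   ≡⟨ theorem (suc n) x y ⟩
    sum (term)                                         ≡⟨ sum-ends term middle ⟩
    term Fin.zero + term (fromℕ (suc n))               ≡⟨ cong₂ _+_ first last ⟩
    y ^ suc n + x ^ suc n                              ≡⟨ +-comm _ _ ⟩
    x ^ suc n + y ^ suc n                              ∎
    where
      open ≡-Reasoning
      term = binomialTerm x y (suc n)
      first : term Fin.zero ≡ y ^ suc n
      first = trans (+-identityʳ _) (trans (*-identityˡ _) (sym (^≡^ y (suc n))))
      last : term (fromℕ (suc n)) ≡ x ^ suc n
      last = begin
        term (fromℕ (suc n))                                    ≡⟨ cong (λ k → (suc n C k) · (x ^ˢ k * y ^ˢ (suc n ℕ.∸ k))) (Fin.toℕ-fromℕ (suc n)) ⟩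
        (suc n C suc n) · (x ^ˢ suc n * y ^ˢ (suc n ℕ.∸ suc n)) ≡⟨ cong₂ (λ c k → c · (x ^ˢ suc n * y ^ˢ k)) (nCn≡1 (suc n)) (ℕ.n∸n≡0 n) ⟩
        1 · (x ^ˢ suc n * 1#)                                   ≡⟨ trans (+-identityʳ _) (*-identityʳ _) ⟩
        x ^ˢ suc n                                              ≡⟨ sym (^≡^ x (suc n)) ⟩
        x ^ suc n                                               ∎
      middle : ∀ i → term (Fin.suc (inject₁ i)) ≡ 0#
      middle i = middle≡0 _ (ℕ.s≤s ℕ.z≤n) (subst (λ k → suc k ℕ.< suc n) (sym (Fin.toℕ-inject₁ i)) (ℕ.s≤s (Fin.toℕ<n i)))

  module _ (p·1≡0 : p · 1# ≡ 0#) where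

    p∣n⇒n·x≡0 : ∀ {n} x → p ∣ n → n · x ≡ 0#
    p∣n⇒n·x≡0 {n} x (divides j refl) = begin
      n · x                   ≡⟨ cong (n ·_) (sym (*-identityˡ x)) ⟩
      n · (1# * x)            ≡⟨ sym (×-assoc-* n 1# x) ⟩
      (n · 1#) * x            ≡⟨ cong (_* x) (×1-homo-* j p) ⟩
      (j · 1#) * (p · 1#) * x ≡⟨ cong (λ c → (j · 1#) * c * x) p·1≡0 ⟩
      (j · 1#) * 0# * x       ≡⟨ cong (_* x) (zeroʳ (j · 1#)) ⟩
      0# * x                  ≡⟨ zeroˡ x ⟩
      0#                      ∎
      where open ≡-Reasoning

    ^p-homo-+ : ∀ x y → (x + y) ^ p ≡ x ^ p + y ^ p
    ^p-homo-+ x y = ^-homo-+ x y (ℕ.>-nonZero⁻¹ p {{prime⇒nonZero p-prime}})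
                      (λ z 0<k k<p → p∣n⇒n·x≡0 z (prime∣C p-prime 0<k k<p))

    ^p^n-homo-+ : ∀ n x y → (x + y) ^ (p ℕ.^ n) ≡ x ^ (p ℕ.^ n) + y ^ (p ℕ.^ n)
    ^p^n-homo-+ zero x y = distribʳ 1# x y
    ^p^n-homo-+ (suc n) x y = begin
      (x + y) ^ (p ℕ.* p ℕ.^ n)              ≡⟨ sym (^-assocʳ (x + y) p (p ℕ.^ n)) ⟩
      ((x + y) ^ p) ^ (p ℕ.^ n)              ≡⟨ cong (_^ (p ℕ.^ n)) (^p-homo-+ x y) ⟩
      (x ^ p + y ^ p) ^ (p ℕ.^ n)            ≡⟨ ^p^n-homo-+ n (x ^ p) (y ^ p) ⟩
      (x ^ p) ^ (p ℕ.^ n) + (y ^ p) ^ (p ℕ.^ n) ≡⟨ cong₂ _+_ (^-assocʳ x p (p ℕ.^ n)) (^-assocʳ y p (p ℕ.^ n)) ⟩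
      x ^ (p ℕ.* p ℕ.^ n) + y ^ (p ℕ.* p ℕ.^ n) ∎
      where open ≡-Reasoning

module EAEquivalence {q : ℕ} (F : FiniteField q) where
  open FiniteField F
  open FiniteFieldProperties F

  additive⇒affine : ∀ {m} → Additive m → Affine m
  additive⇒affine {m} m-additive = m , 0# , m-additive , λ x → sym (+-identityʳ (m x))

  linear-factorization⇒EAEquivalent : ∀ {f g L₁ L₂} → Additive L₁ → Additive L₂ → Permutation L₁ → Permutation L₂ →
                                      (∀ x → f x ≡ L₁ (g (L₂ x))) → EAEquivalent f g
  linear-factorization⇒EAEquivalent {L₁ = L₁} {L₂} L₁-additive L₂-additive L₁-permutation L₂-permutation f≡L₁∘g∘L₂ =
    L₁ , L₂ , (λ _ → 0#) ,
    additive⇒affine L₁-additive , additive⇒affine L₂-additive , additive⇒affine (λ _ _ → sym (+-identityʳ 0#)) ,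
    L₁-permutation , L₂-permutation , λ x → trans (f≡L₁∘g∘L₂ x) (sym (+-identityʳ _))

  scaled-inverse⇒permutation : ∀ {f} g {d} → ¬ d ≡ 0# → (∀ x → g (f x) ≡ d * x) → (∀ y → f (g y) ≡ d * y) → Permutation f
  scaled-inverse⇒permutation {f} g {d} d≢0 g∘f≡d* f∘g≡d* =
    (λ {x} {y} fx≡fy → *-cancelˡ x y d≢0 (trans (sym (g∘f≡d* x)) (trans (cong g fx≡fy) (g∘f≡d* y)))) ,
    (λ y → g (d ⁻¹ * y) , λ { refl → trans (f∘g≡d* (d ⁻¹ * y)) (⁻¹-cancelʳ y d≢0) })

  module Conjugation (Q : ℕ) (conj-+ : ∀ x y → (x + y) ^ Q ≡ x ^ Q + y ^ Q) (conj-involutive : ∀ x → (x ^ Q) ^ Q ≡ x) where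

    conj-0 : 0# ^ Q ≡ 0#
    conj-0 = identityʳ-unique (0# ^ Q) (0# ^ Q) (sym (trans (cong (_^ Q) (sym (+-identityʳ 0#))) (conj-+ 0# 0#)))

    conj-neg : ∀ x → (- x) ^ Q ≡ - (x ^ Q)
    conj-neg x = inverseʳ-unique (x ^ Q) ((- x) ^ Q) (trans (sym (conj-+ x (- x))) (trans (cong (_^ Q) (-‿inverseʳ x)) conj-0))

    linearized : Carrier → Carrier → Carrier → Carrier
    linearized u v x = u * x + v * x ^ Q

    linearized-additive : ∀ u v → Additive (linearized u v)
    linearized-additive u v x y = begin
      u * (x + y) + v * (x + y) ^ Q                ≡⟨ cong (λ z → u * (x + y) + v * z) (conj-+ x y) ⟩
      u * (x + y) + v * (x ^ Q + y ^ Q)            ≡⟨ solve 6 (λ u v x y X Y → u :* (x :+ y) :+ v :* (X :+ Y) := (u :* x :+ v :* X) :+ (u :* y :+ v :* Y)) refl u v x y (x ^ Q) (y ^ Q) ⟩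
      (u * x + v * x ^ Q) + (u * y + v * y ^ Q)    ∎
      where open ≡-Reasoning

    linearized-conj : ∀ u v x → linearized u v x ^ Q ≡ linearized (v ^ Q) (u ^ Q) x
    linearized-conj u v x = begin
      (u * x + v * x ^ Q) ^ Q                      ≡⟨ conj-+ (u * x) (v * x ^ Q) ⟩
      (u * x) ^ Q + (v * x ^ Q) ^ Q                ≡⟨ cong₂ _+_ (^-distrib-* u x Q) (^-distrib-* v (x ^ Q) Q) ⟩
      u ^ Q * x ^ Q + v ^ Q * (x ^ Q) ^ Q          ≡⟨ cong (λ z → u ^ Q * x ^ Q + v ^ Q * z) (conj-involutive x) ⟩
      u ^ Q * x ^ Q + v ^ Q * x                    ≡⟨ +-comm _ _ ⟩
      v ^ Q * x + u ^ Q * x ^ Q                    ∎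
      where open ≡-Reasoning

    linearized-permutation : ∀ u v → ¬ u * u ^ Q + - (v * v ^ Q) ≡ 0# → Permutation (linearized u v)
    linearized-permutation u v D≢0 = scaled-inverse⇒permutation (linearized (u ^ Q) (- v)) D≢0 left right
      where
        left : ∀ x → linearized (u ^ Q) (- v) (linearized u v x) ≡ (u * u ^ Q + - (v * v ^ Q)) * x
        left x = begin
          u ^ Q * linearized u v x + - v * linearized u v x ^ Q   ≡⟨ cong (λ z → u ^ Q * linearized u v x + - v * z) (linearized-conj u v x) ⟩
          u ^ Q * (u * x + v * x ^ Q) + - v * (v ^ Q * x + u ^ Q * x ^ Q)
            ≡⟨ solve 6 (λ u ū v v̄ x x̄ → ū :* (u :* x :+ v :* x̄) :+ (:- v) :* (v̄ :* x :+ ū :* x̄) := (u :* ū :- v :* v̄) :* x) refl u (u ^ Q) v (v ^ Q) x (x ^ Q) ⟩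
          (u * u ^ Q + - (v * v ^ Q)) * x                         ∎
          where open ≡-Reasoning
        right : ∀ y → linearized u v (linearized (u ^ Q) (- v) y) ≡ (u * u ^ Q + - (v * v ^ Q)) * y
        right y = begin
          u * linearized (u ^ Q) (- v) y + v * linearized (u ^ Q) (- v) y ^ Q
            ≡⟨ cong (λ z → u * linearized (u ^ Q) (- v) y + v * z) (linearized-conj (u ^ Q) (- v) y) ⟩
          u * (u ^ Q * y + - v * y ^ Q) + v * ((- v) ^ Q * y + (u ^ Q) ^ Q * y ^ Q)
            ≡⟨ cong₂ (λ a b → u * (u ^ Q * y + - v * y ^ Q) + v * (a * y + b * y ^ Q)) (conj-neg v) (conj-involutive u) ⟩
          u * (u ^ Q * y + - v * y ^ Q) + v * (- (v ^ Q) * y + u * y ^ Q)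
            ≡⟨ solve 6 (λ u ū v v̄ y ȳ → u :* (ū :* y :+ (:- v) :* ȳ) :+ v :* ((:- v̄) :* y :+ u :* ȳ) := (u :* ū :- v :* v̄) :* y) refl u (u ^ Q) v (v ^ Q) y (y ^ Q) ⟩
          (u * u ^ Q + - (v * v ^ Q)) * y   ∎
          where open ≡-Reasoning

    ^-conj : ∀ y n → (y ^ n) ^ Q ≡ (y ^ Q) ^ n
    ^-conj y n = trans (^-assocʳ y n Q) (trans (cong (y ^_) (ℕ.*-comm n Q)) (sym (^-assocʳ y Q n)))

    factorization : ∀ α c x → linearized α (- (α * (c * c))) (linearized 1# c x ^ 2) ≡
                    two * (α * (c * (1# + - (c * c ^ Q)))) * x ^ suc Q + α * (1# + - ((c * c ^ Q) * (c * c ^ Q))) * x ^ 2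
    factorization α c x = begin
      α * y ^ 2 + - (α * (c * c)) * (y ^ 2) ^ Q
        ≡⟨ cong (λ z → α * y ^ 2 + - (α * (c * c)) * z) (trans (^-conj y 2) (cong (_^ 2) (linearized-conj 1# c x))) ⟩
      α * y ^ 2 + - (α * (c * c)) * (c ^ Q * x + 1# ^ Q * x ^ Q) ^ 2
        ≡⟨ cong (λ z → α * y ^ 2 + - (α * (c * c)) * (c ^ Q * x + z * x ^ Q) ^ 2) (1^n≡1 Q) ⟩
      α * y ^ 2 + - (α * (c * c)) * (c ^ Q * x + 1# * x ^ Q) ^ 2
        ≡⟨ solve 5 (λ α c c̄ x x̄ →
             α :* ((:1 :* x :+ c :* x̄) :* ((:1 :* x :+ c :* x̄) :* :1)) :+
             (:- (α :* (c :* c))) :* ((c̄ :* x :+ :1 :* x̄) :* ((c̄ :* x :+ :1 :* x̄) :* :1))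
             := (:1 :+ :1) :* (α :* (c :* (:1 :- c :* c̄))) :* (x :* x̄) :+
                α :* (:1 :- (c :* c̄) :* (c :* c̄)) :* (x :* (x :* :1)))
             refl α c (c ^ Q) x (x ^ Q) ⟩
      two * (α * (c * (1# + - (c * c ^ Q)))) * x ^ suc Q + α * (1# + - ((c * c ^ Q) * (c * c ^ Q))) * x ^ 2 ∎
      where
        open ≡-Reasoning
        y = linearized 1# c x

    module _ {ω} (ω≢1 : ¬ ω ≡ 1#) (ω³≡1 : ω ^ 3 ≡ 1#) (ω-conj : ω ^ Q ≡ ω) where

      1-ω≢0 : ¬ 1# + - ω ≡ 0#
      1-ω≢0 1-ω≡0 = ω≢1 (sym (x∙y⁻¹≈ε⇒x≈y 1# ω 1-ω≡0))

      ω²+ω+1≡0 : ω * ω + ω + 1# ≡ 0#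
      ω²+ω+1≡0 = [ flip contradiction 1-ω≢0 , id ] (x*y≡0⇒x≡0⊎y≡0 (begin
        (1# + - ω) * (ω * ω + ω + 1#) ≡⟨ solve 1 (λ ω → (:1 :- ω) :* (ω :* ω :+ ω :+ :1) := :1 :- ω :* (ω :* (ω :* :1))) refl ω ⟩
        1# + - (ω ^ 3)                ≡⟨ cong (λ z → 1# + - z) ω³≡1 ⟩
        1# + - 1#                     ≡⟨ -‿inverseʳ 1# ⟩
        0#                            ∎))
        where open ≡-Reasoning

      ω≢0 : ¬ ω ≡ 0#
      ω≢0 ω≡0 = 1≢0 (trans (sym ω³≡1) (trans (cong (_^ 3) ω≡0) (zeroˡ _)))

      module Coefficients {a} (a≢0 : ¬ a ≡ 0#) where

        c : Carrier
        c = (1# + ω) * (a * a ⁻¹ ^ Q)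

        a^Q*a⁻¹^Q≡1 : a ^ Q * a ⁻¹ ^ Q ≡ 1#
        a^Q*a⁻¹^Q≡1 = trans (sym (^-distrib-* a (a ⁻¹) Q)) (trans (cong (_^ Q) (⁻¹-inverseʳ a≢0)) (1^n≡1 Q))

        cc̄≡ω : c * c ^ Q ≡ ω
        cc̄≡ω = begin
          c * c ^ Q                                          ≡⟨ cong (c *_) c̄≡ ⟩
          (1# + ω) * (a * e ^ Q) * ((1# + ω) * (a ^ Q * e))  ≡⟨ solve 5 (λ ω a e A E → (:1 :+ ω) :* (a :* E) :* ((:1 :+ ω) :* (A :* e)) := (ω :+ (ω :* ω :+ ω :+ :1)) :* ((a :* e) :* (A :* E))) refl ω a e (a ^ Q) (e ^ Q) ⟩
          (ω + (ω * ω + ω + 1#)) * ((a * e) * (a ^ Q * e ^ Q)) ≡⟨ cong₂ (λ z w → (ω + z) * (w * (a ^ Q * e ^ Q))) ω²+ω+1≡0 (⁻¹-inverseʳ a≢0) ⟩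
          (ω + 0#) * (1# * (a ^ Q * e ^ Q))                  ≡⟨ cong (λ z → (ω + 0#) * (1# * z)) a^Q*a⁻¹^Q≡1 ⟩
          (ω + 0#) * (1# * 1#)                               ≡⟨ solve 1 (λ ω → (ω :+ :0) :* (:1 :* :1) := ω) refl ω ⟩
          ω                                                  ∎
          where
            open ≡-Reasoning
            e = a ⁻¹
            c̄≡ : c ^ Q ≡ (1# + ω) * (a ^ Q * e)
            c̄≡ = begin
              ((1# + ω) * (a * e ^ Q)) ^ Q          ≡⟨ ^-distrib-* (1# + ω) (a * e ^ Q) Q ⟩
              (1# + ω) ^ Q * (a * e ^ Q) ^ Q        ≡⟨ cong₂ _*_ (trans (conj-+ 1# ω) (cong₂ _+_ (1^n≡1 Q) ω-conj)) (^-distrib-* a (e ^ Q) Q) ⟩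
              (1# + ω) * (a ^ Q * (e ^ Q) ^ Q)      ≡⟨ cong (λ z → (1# + ω) * (a ^ Q * z)) (conj-involutive e) ⟩
              (1# + ω) * (a ^ Q * e)                ∎

        c≢0 : ¬ c ≡ 0#
        c≢0 c≡0 = ω≢0 (trans (sym cc̄≡ω) (trans (cong (_* c ^ Q) c≡0) (zeroˡ (c ^ Q))))

        α : Carrier
        α = a * (c * (1# + - ω)) ⁻¹

        α[c[1-ω]]≡a : α * (c * (1# + - ω)) ≡ a
        α[c[1-ω]]≡a = trans (*-assoc a _ _) (trans (cong (a *_) (⁻¹-inverseˡ (x≢0∧y≢0⇒x*y≢0 c≢0 1-ω≢0))) (*-identityʳ a))

        α[1-ω²]≡ā : α * (1# + - (ω * ω)) ≡ a ^ Q
        α[1-ω²]≡ā = *-cancelˡ _ _ c≢0 (begin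
          c * (α * (1# + - (ω * ω)))               ≡⟨ solve 3 (λ c α ω → c :* (α :* (:1 :- ω :* ω)) := α :* (c :* (:1 :- ω)) :* (:1 :+ ω)) refl c α ω ⟩
          α * (c * (1# + - ω)) * (1# + ω)          ≡⟨ cong (_* (1# + ω)) α[c[1-ω]]≡a ⟩
          a * (1# + ω)                             ≡⟨ sym (trans (cong (a * (1# + ω) *_) a^Q*a⁻¹^Q≡1) (*-identityʳ _)) ⟩
          a * (1# + ω) * (a ^ Q * a ⁻¹ ^ Q)        ≡⟨ solve 4 (λ ω a A E → a :* (:1 :+ ω) :* (A :* E) := (:1 :+ ω) :* (a :* E) :* A) refl ω a (a ^ Q) (a ⁻¹ ^ Q) ⟩
          c * a ^ Q                                ∎)
          where open ≡-Reasoning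

        α≢0 : ¬ α ≡ 0#
        α≢0 α≡0 = a≢0 (trans (sym α[c[1-ω]]≡a) (trans (cong (_* (c * (1# + - ω))) α≡0) (zeroˡ _)))

        1-ω²≢0 : ¬ 1# + - (ω * ω) ≡ 0#
        1-ω²≢0 1-ω²≡0 = a≢0 (x^n≡0⇒x≡0 Q (trans (sym α[1-ω²]≡ā) (trans (cong (α *_) 1-ω²≡0) (zeroʳ α))))

        β : Carrier
        β = - (α * (c * c))

        D₂≢0 : ¬ 1# * 1# ^ Q + - (c * c ^ Q) ≡ 0#
        D₂≢0 D₂≡0 = 1-ω≢0 (trans (cong₂ (λ u v → u + - v) (sym (trans (*-identityˡ _) (1^n≡1 Q))) (sym cc̄≡ω)) D₂≡0)

        D₁≡ : α * α ^ Q + - (β * β ^ Q) ≡ α * α ^ Q * (1# + - (ω * ω))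
        D₁≡ = begin
          α * α ^ Q + - (β * β ^ Q)                          ≡⟨ cong (λ z → α * α ^ Q + - (β * z)) β̄≡ ⟩
          α * α ^ Q + - (β * - (α ^ Q * (c ^ Q * c ^ Q)))    ≡⟨ solve 4 (λ α ᾱ c c̄ → α :* ᾱ :- (:- (α :* (c :* c))) :* (:- (ᾱ :* (c̄ :* c̄))) := α :* ᾱ :* (:1 :- (c :* c̄) :* (c :* c̄))) refl α (α ^ Q) c (c ^ Q) ⟩
          α * α ^ Q * (1# + - ((c * c ^ Q) * (c * c ^ Q)))   ≡⟨ cong (λ z → α * α ^ Q * (1# + - (z * z))) cc̄≡ω ⟩
          α * α ^ Q * (1# + - (ω * ω))                       ∎
          where
            open ≡-Reasoning
            β̄≡ : β ^ Q ≡ - (α ^ Q * (c ^ Q * c ^ Q))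
            β̄≡ = trans (conj-neg (α * (c * c))) (cong -_ (trans (^-distrib-* α (c * c) Q) (cong (α ^ Q *_) (^-distrib-* c c Q))))

        D₁≢0 : ¬ α * α ^ Q + - (β * β ^ Q) ≡ 0#
        D₁≢0 D₁≡0 = x≢0∧y≢0⇒x*y≢0 (x≢0∧y≢0⇒x*y≢0 α≢0 (α≢0 ∘ x^n≡0⇒x≡0 Q)) 1-ω²≢0 (trans (sym D₁≡) D₁≡0)

        Π-factorization : ∀ x → Πpoly Q a x ≡ linearized α β (linearized 1# c x ^ 2)
        Π-factorization x = begin
          two * a * x ^ suc Q + a ^ Q * x ^ 2
            ≡⟨ sym (cong₂ (λ u v → two * u * x ^ suc Q + v * x ^ 2) α[c[1-ω]]≡a α[1-ω²]≡ā) ⟩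
          two * (α * (c * (1# + - ω))) * x ^ suc Q + α * (1# + - (ω * ω)) * x ^ 2
            ≡⟨ sym (cong (λ z → two * (α * (c * (1# + - z))) * x ^ suc Q + α * (1# + - (z * z)) * x ^ 2) cc̄≡ω) ⟩
          two * (α * (c * (1# + - (c * c ^ Q)))) * x ^ suc Q + α * (1# + - ((c * c ^ Q) * (c * c ^ Q))) * x ^ 2
            ≡⟨ sym (factorization α c x) ⟩
          linearized α β (linearized 1# c x ^ 2) ∎
          where open ≡-Reasoning

      Π-EAEquivalent-square : ∀ {a} → ¬ a ≡ 0# → EAEquivalent (Πpoly Q a) (λ x → x ^ 2)
      Π-EAEquivalent-square a≢0 =
        linear-factorization⇒EAEquivalent {g = λ x → x ^ 2} (linearized-additive α β) (linearized-additive 1# c)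
          (linearized-permutation α β D₁≢0) (linearized-permutation 1# c D₂≢0) Π-factorization
        where open Coefficients a≢0

open import Data.Nat using (_+_; _*_; _^_; _≤_)

mainTheorem6 : (p r : ℕ) → Prime p → 5 ≤ p → 1 ≤ r → ¬ (3 ∣ (p ^ r) + 1) →
    (F : FiniteField (p ^ (2 * r))) →
    (a : FiniteField.Carrier F) → ¬ (a ≡ FiniteField.0# F) →
    FiniteField.EAEquivalent F (FiniteField.Πpoly F (p ^ r) a) (λ x → FiniteField._^_ F x 2)
mainTheorem6 p r p-prime 5≤p _ 3∤Q+1 F a a≢0 =
  let ω , ω≢1 , ω³≡1 = nontrivialCubeRootOfUnity (subst (λ n → n % 3 ≡ 1) (sym q≡Q*Q) (n%3≡1⇒n*n%3≡1 Q Q%3≡1)) in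
  Conjugation.Π-EAEquivalent-square Q (FrobeniusMap.^p^n-homo-+ F p-prime (q≡p^n⇒p·1≡0 (2 * r) refl) r)
    (q≡Q*Q⇒[x^Q]^Q≡x {Q} q≡Q*Q) ω≢1 ω³≡1 (x³≡1⇒x^n≡x ω³≡1 Q Q%3≡1) a≢0
  where
    open FiniteFieldProperties F
    open EAEquivalence F
    Q = p ^ r
    q≡Q*Q : p ^ (2 * r) ≡ Q * Q
    q≡Q*Q = trans (ℕ.^-distribˡ-+-* p r (r + 0)) (cong (λ k → Q * p ^ k) (ℕ.+-identityʳ r))
    Q%3≡1 : Q % 3 ≡ 1
    Q%3≡1 = 3∤n∧3∤n+1⇒n%3≡1 Q (prime∤⇒∤^ (from-yes (prime? 3)) (prime≥5⇒3∤ p-prime 5≤p) r) 3∤Q+1
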